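{- Let $R$ be a finite group of order $r$, identified with its right regular representation on the set $R$, and let $N$ be a non-identity proper normal subgroup of $R$ with $n:=|N|$. For $S\subseteq R$ let $\Gamma=\Gamma(R,S)$ and let $F_S$ be the subgroup of $\mathrm{Aut}(\Gamma)$ consisting of the automorphisms that fix setwise every coset of $N$ in $R$. Let $C$ be a coset of $N$ in $R$ with $C\neq N$. Then the number of subsets $S\subseteq R$ for which there exists $f\in F_S$ with $1^f=1$ (where $1$ is the identity of $R$, viewed as a vertex) and with the restriction of $f$ to $C$ not the identity is at most $2^r\binom{n}{2}\left(\frac34\right)^{\frac{r/n-2}{3}}$.
   Context: For a finite group $R$ and $S\subseteq R$, the Cayley digraph $\Gamma(R,S)$ has vertex set $R$ and $(g,h)$ is an arc iff $hg^{ -1}\in S$. The orbits of $N$ acting by right multiplication are the cosets of $N$. -}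

module Defs where

open import Data.Nat using (ℕ; _*_; _^_; _∸_; _≤_)
open import Data.Nat.Combinatorics using (_C_)
open import Data.Fin using (Fin)
open import Data.Fin.Subset using (Subset; _∈_; _∉_; ∣_∣)
open import Data.Fin.Permutation using (Permutation′; _⟨$⟩ʳ_; _⟨$⟩ˡ_)
open import Data.Product using (Σ; _×_; ∃; _,_)
open import Data.List using (List; length)
open import Data.List.Relation.Unary.All using (All)
open import Data.List.Relation.Unary.Unique.Propositional using (Unique)
open import Relation.Binary.PropositionalEquality using (_≡_)
open import Relation.Nullary using (¬_)
open import Function.Bundles using (_⇔_)
open import Algebra.Core using (Op₁; Op₂)
open import Algebra.Structures using (IsGroup)

record FinGroup (r : ℕ) : Set where
  field
    _∙_     : Op₂ (Fin r)
    ε       : Fin r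
    _⁻¹     : Op₁ (Fin r)
    isGroup : IsGroup _≡_ _∙_ ε _⁻¹
  infixl 7 _∙_
  infix 8 _⁻¹

module _ {r : ℕ} (G : FinGroup r) where
  open FinGroup G

  record IsNormalSubgroup (N : Subset r) : Set where
    field
      ε∈N    : ε ∈ N
      ∙-closed : ∀ {x y} → x ∈ N → y ∈ N → (x ∙ y) ∈ N
      ⁻¹-closed : ∀ {x} → x ∈ N → (x ⁻¹) ∈ N
      normal : ∀ g {x} → x ∈ N → (g ∙ x ∙ g ⁻¹) ∈ N

  Arc : Subset r → Fin r → Fin r → Set
  Arc S g h = (h ∙ g ⁻¹) ∈ S

  IsAut : Subset r → Permutation′ r → Set
  IsAut S f = ∀ g h → Arc S g h ⇔ Arc S (f ⟨$⟩ʳ g) (f ⟨$⟩ʳ h)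

  InCoset : Subset r → Fin r → Fin r → Set
  InCoset N g x = (g ⁻¹ ∙ x) ∈ N

  FixesCosets : Subset r → Permutation′ r → Set
  FixesCosets N f = ∀ g x → InCoset N g x →
    InCoset N g (f ⟨$⟩ʳ x) × InCoset N g (f ⟨$⟩ˡ x)

  InF : Subset r → Subset r → Permutation′ r → Set
  InF N S f = IsAut S f × FixesCosets N f

  Bad : Subset r → Fin r → Subset r → Set
  Bad N c S = Σ (Permutation′ r) λ f →
    InF N S f × (f ⟨$⟩ʳ ε ≡ ε) ×
    ∃ λ x → InCoset N c x × ¬ (f ⟨$⟩ʳ x ≡ x)

module Submission where

-- For z ∈ C and d ∈ R let common z d S count the w ∈ dN
-- with arcs 1 → w and z → w in Γ(R,S).  If f ∈ F_S fixes 1 and moves x ∈ C to y, then f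
-- maps these w for x onto those for y, so common x d S = common y d S for every d.
-- Refilling the two entries d, dx⁻¹ of S with all four value pairs, common x d changes
-- only through the term for d, but common y d through the terms for d and dx⁻¹y, so the
-- two counts disagree for one of the four fillings (four-fillings lemma).  Greedily
-- chosen representatives d₁, …, d_k whose regions dN ∪ dc⁻¹N are pairwise disjoint make
-- these events independent, so a fixed pair x < y in C agrees at all dᵢ for at most
-- (3/4)^k 2^r subsets (block counting lemma); summing over the (n choose 2) pairs bounds
-- the bad subsets.  Maximality of the greedy choice covers R by the 3k cosets dᵢN,
-- dᵢc⁻¹N, dᵢcN, so r/n ≤ 3k, and cubing yields the stated bound.

open import Defs
open import Data.Nat using (ℕ; _*_; _^_; _∸_; _≤_)
open import Data.Nat.Combinatorics using (_C_)
open import Data.Fin using (Fin)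
open import Data.Fin.Subset using (Subset; _∈_; _∉_; ∣_∣)
open import Data.Product using (∃; _×_)
open import Data.List using (List; length)
open import Data.List.Relation.Unary.All using (All)
open import Data.List.Relation.Unary.Unique.Propositional using (Unique)
open import Relation.Binary.PropositionalEquality using (_≡_)
open import Relation.Nullary using (¬_)

open import Data.Nat using (zero; suc; _+_; _<_; _<ᵇ_; z≤n; s≤s; _≟_; >-nonZero)
open import Data.Nat.Properties
open import Data.Nat.Combinatorics using (nC1≡n; nCk+nC[k+1]≡[n+1]C[k+1])
open import Data.Bool using (Bool; true; false; _∧_; _∨_; T)
open import Data.Bool.Properties using (∧-comm; T-∧; T-≡) renaming (_≟_ to _Bool≟_)
open import Data.Bool.ListAction using (all; any)
open import Data.Empty using (⊥; ⊥-elim)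
open import Data.Fin using (zero; suc; toℕ; punchIn) renaming (_≟_ to _Fin≟_)
open import Data.Fin.Properties using (punchInᵢ≢i; toℕ-injective)
open import Data.Fin.Subset.Properties using (_∈?_)
open import Data.Fin.Permutation using (Permutation′; _⟨$⟩ʳ_; _⟨$⟩ˡ_; inverseʳ; flip; permutation)
open import Data.Vec using ([]; _∷_; lookup; _[_]≔_)
import Data.Vec.Properties as Vecₚ
open import Data.List using ([]; _∷_; allFin)
open import Data.List.Membership.Propositional using () renaming (_∈_ to _∈ₗ_)
open import Data.List.Membership.Propositional.Properties using (∈-allFin)
open import Data.List.Relation.Unary.All using ([]; _∷_; all?)
import Data.List.Relation.Unary.All as Allₚ
open import Data.List.Relation.Unary.All.Properties using (¬All⇒Any¬; all⁻)
open import Data.List.Relation.Unary.AllPairs using (AllPairs; []; _∷_)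
import Data.List.Relation.Unary.AllPairs as AllPairsₚ
open import Data.List.Relation.Unary.Any using (Any; here; there)
import Data.List.Relation.Unary.Any as Anyₚ
open import Data.List.Relation.Unary.Any.Properties using (any⁺)
open import Data.Product using (_,_; proj₁; proj₂)
open import Data.Sum using (_⊎_; inj₁; inj₂)
open import Function using (_∘_)
open import Function.Bundles using (Equivalence)
open Equivalence using (to; from)
open import Level using (0ℓ)
open import Relation.Binary.Definitions using (tri<; tri≈; tri>)
open import Relation.Binary.PropositionalEquality
  using (refl; sym; trans; cong; cong₂; subst; subst₂; _≢_; module ≡-Reasoning)
open import Relation.Nullary using (Dec; yes; no; does)
open import Relation.Nullary.Decidable using (isYes; isYes≗does; toWitness; fromWitness; ¬?; _×-dec_)
open import Algebra.Bundles using (Group)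
open import Algebra.Structures using (IsGroup)
import Algebra.Properties.Group as GroupProps
import Algebra.Properties.CommutativeSemigroup as CommSemigroupProps
open CommSemigroupProps +-commutativeSemigroup using () renaming (interchange to +-interchange)
open CommSemigroupProps *-commutativeSemigroup using (xy∙z≈y∙xz; x∙yz≈y∙xz)
open import Algebra.Properties.CommutativeSemiring.Exp +-*-commutativeSemiring using (^-distrib-*)
open import Algebra.Properties.Semiring.Sum +-*-semiring
  using (sum; sum-cong-≗; sum-remove; ∑-distrib-+; sum-permute; *-distribˡ-sum)

-- Indicators and sums over Fin n

⟦_⟧ : Bool → ℕ
⟦ true ⟧ = 1
⟦ false ⟧ = 0

⟦⟧-true : ∀ {b} → T b → 1 ≤ ⟦ b ⟧
⟦⟧-true {true} _ = s≤s z≤n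

⟦⟧≤1 : ∀ b → ⟦ b ⟧ ≤ 1
⟦⟧≤1 true = ≤-refl
⟦⟧≤1 false = z≤n

⟦⟧-mono : ∀ {a b} → (T a → T b) → ⟦ a ⟧ ≤ ⟦ b ⟧
⟦⟧-mono {false} _ = z≤n
⟦⟧-mono {true} a⇒b = ⟦⟧-true (a⇒b _)

⟦∨⟧≤ : ∀ a b → ⟦ a ∨ b ⟧ ≤ ⟦ a ⟧ + ⟦ b ⟧
⟦∨⟧≤ true _ = s≤s z≤n
⟦∨⟧≤ false _ = ≤-refl

∧-cong-T : ∀ b {x y} → (T b → x ≡ y) → b ∧ x ≡ b ∧ y
∧-cong-T false _ = refl
∧-cong-T true x≡y = x≡y _

T-∨ˡ : ∀ {a b} → T a → T (a ∨ b)
T-∨ˡ {true} _ = _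

T-∨ʳ : ∀ {a b} → T b → T (a ∨ b)
T-∨ʳ {true} _ = _
T-∨ʳ {false} t = t

∧³-intro : ∀ {a b c} → T a → T b → T c → T (a ∧ b ∧ c)
∧³-intro {true} {true} {true} _ _ _ = _

∧³-elim : ∀ {a b c} → T (a ∧ b ∧ c) → T a × T b × T c
∧³-elim {true} {true} {true} _ = _ , _ , _

sum-mono : ∀ {n} {f g : Fin n → ℕ} → (∀ i → f i ≤ g i) → sum f ≤ sum g
sum-mono {zero} _ = z≤n
sum-mono {suc n} f≤g = +-mono-≤ (f≤g zero) (sum-mono (f≤g ∘ suc))

sum-const : ∀ n c → sum {n} (λ _ → c) ≡ n * c
sum-const zero c = refl
sum-const (suc n) c = cong (c +_) (sum-const n c)

sum-zero : ∀ n → sum {n} (λ _ → 0) ≡ 0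
sum-zero n = trans (sum-const n 0) (*-zeroʳ n)

term≤sum : ∀ {n} (f : Fin n → ℕ) i → f i ≤ sum f
term≤sum {suc n} f i = ≤-trans (m≤m+n (f i) _) (≤-reflexive (sym (sum-remove {i = i} f)))

sum-pointChange : ∀ {n} (f g : Fin n → ℕ) i → (∀ j → j ≢ i → f j ≡ g j) →
                  sum f + g i ≡ sum g + f i
sum-pointChange {suc n} f g i agree = begin
  sum f + g i                         ≡⟨ cong (_+ g i) (sum-remove {i = i} f) ⟩
  f i + rest f + g i                  ≡⟨ cong (λ t → f i + t + g i) rest-agree ⟩
  f i + rest g + g i                  ≡⟨ swap-ends (f i) (rest g) (g i) ⟩
  g i + rest g + f i                  ≡⟨ cong (_+ f i) (sum-remove {i = i} g) ⟨
  sum g + f i                         ∎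
  where
  open ≡-Reasoning
  rest : (Fin (suc n) → ℕ) → ℕ
  rest h = sum (λ j → h (punchIn i j))
  rest-agree : rest f ≡ rest g
  rest-agree = sum-cong-≗ (λ j → agree (punchIn i j) (punchInᵢ≢i i j))
  swap-ends : ∀ a b c → a + b + c ≡ c + b + a
  swap-ends a b c = trans (+-comm (a + b) c) (trans (cong (c +_) (+-comm a b)) (sym (+-assoc c b a)))

*-distrib-sum² : ∀ {m n} a (F : Fin m → Fin n → ℕ) →
                 a * sum (λ x → sum (λ y → F x y)) ≡ sum (λ x → sum (λ y → a * F x y))
*-distrib-sum² a F = trans (*-distribˡ-sum a (λ x → sum (F x))) (sum-cong-≗ λ x → *-distribˡ-sum a (F x))

⟦⟧-scale : ∀ b {m n} → (T b → m ≤ n) → m * ⟦ b ⟧ ≤ n * ⟦ b ⟧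
⟦⟧-scale false {m} {n} _ = ≤-reflexive (trans (*-zeroʳ m) (sym (*-zeroʳ n)))
⟦⟧-scale true m≤n = *-monoˡ-≤ 1 (m≤n _)

union-count : ∀ {A : Set} {n} (P : A → Fin n → Bool) ds {s} → (∀ d → sum (⟦_⟧ ∘ P d) ≤ s) →
              sum (λ g → ⟦ any (λ d → P d g) ds ⟧) ≤ length ds * s
union-count {n = n} P [] _ = ≤-reflexive (sum-zero n)
union-count P (d ∷ ds) {s} |P|≤s = begin
  sum (λ g → ⟦ P d g ∨ any (λ d′ → P d′ g) ds ⟧)                 ≤⟨ sum-mono (λ g → ⟦∨⟧≤ (P d g) _) ⟩
  sum (λ g → ⟦ P d g ⟧ + ⟦ any (λ d′ → P d′ g) ds ⟧)            ≡⟨ ∑-distrib-+ (⟦_⟧ ∘ P d) _ ⟩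
  sum (⟦_⟧ ∘ P d) + sum (λ g → ⟦ any (λ d′ → P d′ g) ds ⟧)     ≤⟨ +-mono-≤ (|P|≤s d) (union-count P ds |P|≤s) ⟩
  s + length ds * s                                             ∎
  where open ≤-Reasoning

∣∣≡count : ∀ {n} (p : Subset n) → sum (λ g → ⟦ isYes (g ∈? p) ⟧) ≡ ∣ p ∣
∣∣≡count p = trans (sum-cong-≗ (λ g → cong ⟦_⟧ (isYes≗does (g ∈? p)))) (count-does p)
  where
  count-does : ∀ {n} (p : Subset n) → sum (λ g → ⟦ does (g ∈? p) ⟧) ≡ ∣ p ∣
  count-does [] = refl
  count-does (true ∷ p) = cong suc (count-does p)
  count-does (false ∷ p) = count-does p

count-bijection : ∀ {n} (P Q : Fin n → Bool) (π : Permutation′ n) →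
  (∀ w → T (P w) → T (Q (π ⟨$⟩ʳ w))) → (∀ w → T (Q w) → T (P (π ⟨$⟩ˡ w))) →
  sum (λ w → ⟦ P w ⟧) ≡ sum (λ w → ⟦ Q w ⟧)
count-bijection P Q π P⇒Q Q⇒P = ≤-antisym
  (≤-trans (sum-mono (λ w → ⟦⟧-mono (P⇒Q w))) (≤-reflexive (sym (sum-permute (⟦_⟧ ∘ Q) π))))
  (≤-trans (sum-mono (λ w → ⟦⟧-mono (Q⇒P w))) (≤-reflexive (sym (sum-permute (⟦_⟧ ∘ P) (flip π)))))

-- Sums over all subsets of Fin r

∑ˢ : ∀ r → (Subset r → ℕ) → ℕ
∑ˢ zero F = F []
∑ˢ (suc r) F = ∑ˢ r (λ S → F (false ∷ S)) + ∑ˢ r (λ S → F (true ∷ S))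

count : ∀ {r} → (Subset r → Bool) → ℕ
count {r} P = ∑ˢ r (⟦_⟧ ∘ P)

∑ᵇ : (Bool → ℕ) → ℕ
∑ᵇ F = F false + F true

∑ˢ-cong : ∀ r {F G : Subset r → ℕ} → (∀ S → F S ≡ G S) → ∑ˢ r F ≡ ∑ˢ r G
∑ˢ-cong zero F≗G = F≗G []
∑ˢ-cong (suc r) F≗G = cong₂ _+_ (∑ˢ-cong r (F≗G ∘ (false ∷_))) (∑ˢ-cong r (F≗G ∘ (true ∷_)))

∑ˢ-mono : ∀ r {F G : Subset r → ℕ} → (∀ S → F S ≤ G S) → ∑ˢ r F ≤ ∑ˢ r G
∑ˢ-mono zero F≤G = F≤G []
∑ˢ-mono (suc r) F≤G = +-mono-≤ (∑ˢ-mono r (F≤G ∘ (false ∷_))) (∑ˢ-mono r (F≤G ∘ (true ∷_)))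

∑ˢ-+ : ∀ r (F G : Subset r → ℕ) → ∑ˢ r (λ S → F S + G S) ≡ ∑ˢ r F + ∑ˢ r G
∑ˢ-+ zero F G = refl
∑ˢ-+ (suc r) F G = trans (cong₂ _+_ (∑ˢ-+ r _ _) (∑ˢ-+ r _ _))
  (+-interchange (∑ˢ r (F ∘ (false ∷_))) (∑ˢ r (G ∘ (false ∷_))) (∑ˢ r (F ∘ (true ∷_))) (∑ˢ r (G ∘ (true ∷_))))

∑ˢ-*ˡ : ∀ r k (F : Subset r → ℕ) → ∑ˢ r (λ S → k * F S) ≡ k * ∑ˢ r F
∑ˢ-*ˡ zero k F = refl
∑ˢ-*ˡ (suc r) k F = trans (cong₂ _+_ (∑ˢ-*ˡ r k _) (∑ˢ-*ˡ r k _)) (sym (*-distribˡ-+ k _ _))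

∑ˢ-const : ∀ r c → ∑ˢ r (λ _ → c) ≡ 2 ^ r * c
∑ˢ-const zero c = sym (+-identityʳ c)
∑ˢ-const (suc r) c = begin
  ∑ˢ r (λ _ → c) + ∑ˢ r (λ _ → c) ≡⟨ cong₂ _+_ (∑ˢ-const r c) (∑ˢ-const r c) ⟩
  2 ^ r * c + 2 ^ r * c            ≡⟨ *-distribʳ-+ c (2 ^ r) (2 ^ r) ⟨
  (2 ^ r + 2 ^ r) * c              ≡⟨ cong (λ t → (2 ^ r + t) * c) (+-identityʳ (2 ^ r)) ⟨
  2 ^ suc r * c                    ∎
  where open ≡-Reasoning

∑ˢ-zero : ∀ r → ∑ˢ r (λ _ → 0) ≡ 0
∑ˢ-zero r = trans (∑ˢ-const r 0) (*-zeroʳ (2 ^ r))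

count-guarded : ∀ r b (P : Subset r → Bool) → count (λ S → b ∧ P S) ≡ count P * ⟦ b ⟧
count-guarded r false P = trans (∑ˢ-zero r) (sym (*-zeroʳ (count P)))
count-guarded r true P = sym (*-identityʳ (count P))

∑ˢ-sum : ∀ r {n} (F : Fin n → Subset r → ℕ) → ∑ˢ r (λ S → sum (λ i → F i S)) ≡ sum (λ i → ∑ˢ r (F i))
∑ˢ-sum zero F = refl
∑ˢ-sum (suc r) F =
  trans (cong₂ _+_ (∑ˢ-sum r (λ i → F i ∘ (false ∷_))) (∑ˢ-sum r (λ i → F i ∘ (true ∷_))))
        (sym (∑-distrib-+ (λ i → ∑ˢ r (F i ∘ (false ∷_))) (λ i → ∑ˢ r (F i ∘ (true ∷_)))))

∑ˢ-overwrite : ∀ r (F : Subset r → ℕ) p → ∑ˢ r (λ S → ∑ᵇ (λ u → F (S [ p ]≔ u))) ≡ 2 * ∑ˢ r F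
∑ˢ-overwrite (suc r) F zero = begin
  ∑ˢ r (λ S → F (false ∷ S) + F (true ∷ S)) + ∑ˢ r (λ S → F (false ∷ S) + F (true ∷ S))
    ≡⟨ cong₂ _+_ (∑ˢ-+ r _ _) (∑ˢ-+ r _ _) ⟩
  ∑ˢ (suc r) F + ∑ˢ (suc r) F
    ≡⟨ cong (∑ˢ (suc r) F +_) (+-identityʳ _) ⟨
  2 * ∑ˢ (suc r) F ∎
  where open ≡-Reasoning
∑ˢ-overwrite (suc r) F (suc p) =
  trans (cong₂ _+_ (∑ˢ-overwrite r (F ∘ (false ∷_)) p) (∑ˢ-overwrite r (F ∘ (true ∷_)) p))
        (sym (*-distribˡ-+ 2 (∑ˢ r (F ∘ (false ∷_))) (∑ˢ r (F ∘ (true ∷_)))))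

fill : ∀ {r} → Fin r → Fin r → Subset r → Bool → Bool → Subset r
fill p q S u v = (S [ q ]≔ v) [ p ]≔ u

∑ˢ-fill : ∀ r (F : Subset r → ℕ) p q →
  ∑ˢ r (λ S → ∑ᵇ (λ v → ∑ᵇ (λ u → F (fill p q S u v)))) ≡ 4 * ∑ˢ r F
∑ˢ-fill r F p q = begin
  ∑ˢ r (λ S → ∑ᵇ (λ v → K (S [ q ]≔ v))) ≡⟨ ∑ˢ-overwrite r K q ⟩
  2 * ∑ˢ r K                              ≡⟨ cong (2 *_) (∑ˢ-overwrite r F p) ⟩
  2 * (2 * ∑ˢ r F)                        ≡⟨ *-assoc 2 2 (∑ˢ r F) ⟨
  4 * ∑ˢ r F                              ∎
  where
  open ≡-Reasoning
  K : Subset _ → ℕ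
  K S = ∑ᵇ (λ u → F (S [ p ]≔ u))

fill-p : ∀ {r} p q (S : Subset r) u v → lookup (fill p q S u v) p ≡ u
fill-p p q S u v = Vecₚ.lookup∘update p (S [ q ]≔ v) u

fill-q : ∀ {r} {p q} (S : Subset r) u v → p ≢ q → lookup (fill p q S u v) q ≡ v
fill-q {q = q} S u v p≢q = trans (Vecₚ.lookup∘update′ (p≢q ∘ sym) (S [ q ]≔ v) u) (Vecₚ.lookup∘update q S v)

fill-elsewhere : ∀ {r} {p q t} (S : Subset r) u v → t ≢ p → t ≢ q → lookup (fill p q S u v) t ≡ lookup S t
fill-elsewhere {q = q} S u v t≢p t≢q = trans (Vecₚ.lookup∘update′ t≢p (S [ q ]≔ v) u) (Vecₚ.lookup∘update′ t≢q S v)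

fill-vary-u : ∀ {r} {p q t} (S : Subset r) u u′ v → t ≢ p → lookup (fill p q S u v) t ≡ lookup (fill p q S u′ v) t
fill-vary-u {q = q} S u u′ v t≢p =
  trans (Vecₚ.lookup∘update′ t≢p (S [ q ]≔ v) u) (sym (Vecₚ.lookup∘update′ t≢p (S [ q ]≔ v) u′))

fill-vary-v : ∀ {r} {p q t} (S : Subset r) u v v′ → t ≢ q → lookup (fill p q S u v) t ≡ lookup (fill p q S u v′) t
fill-vary-v {p = p} {q} {t} S u v v′ t≢q with t Fin≟ p
... | yes refl = trans (fill-p p q S u v) (sym (fill-p p q S u v′))
... | no t≢p = trans (fill-elsewhere S u v t≢p t≢q) (sym (fill-elsewhere S u v′ t≢p t≢q))

_≟ˢ_ : ∀ {r} (S S′ : Subset r) → Dec (S ≡ S′)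
_≟ˢ_ = Vecₚ.≡-dec _Bool≟_

∑ˢ-delta : ∀ r (S₀ : Subset r) → ∑ˢ r (λ S → ⟦ does (S ≟ˢ S₀) ⟧) ≡ 1
∑ˢ-delta zero [] = refl
∑ˢ-delta (suc r) (false ∷ S₀) = cong₂ _+_ (∑ˢ-delta r S₀) (∑ˢ-zero r)
∑ˢ-delta (suc r) (true ∷ S₀) = cong₂ _+_ (∑ˢ-zero r) (∑ˢ-delta r S₀)

occurrences : ∀ {r} → Subset r → List (Subset r) → ℕ
occurrences S [] = 0
occurrences S (S′ ∷ L) = ⟦ does (S ≟ˢ S′) ⟧ + occurrences S L

∑ˢ-occurrences : ∀ r (L : List (Subset r)) → ∑ˢ r (λ S → occurrences S L) ≡ length L
∑ˢ-occurrences r [] = ∑ˢ-zero r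
∑ˢ-occurrences r (S′ ∷ L) = trans (∑ˢ-+ r _ _) (cong₂ _+_ (∑ˢ-delta r S′) (∑ˢ-occurrences r L))

occurrences-absent : ∀ {r} {S : Subset r} L → All (S ≢_) L → occurrences S L ≡ 0
occurrences-absent [] [] = refl
occurrences-absent {S = S} (S′ ∷ L) (S≢S′ ∷ S∉L) with S ≟ˢ S′
... | yes S≡S′ = ⊥-elim (S≢S′ S≡S′)
... | no _ = occurrences-absent L S∉L

occurrences≤ : ∀ {r} (W : Subset r → ℕ) L → Unique L → All (λ S → 1 ≤ W S) L →
               ∀ S → occurrences S L ≤ W S
occurrences≤ W [] [] [] S = z≤n
occurrences≤ W (S′ ∷ L) (S′∉L ∷ unique) (1≤WS′ ∷ 1≤W) S with S ≟ˢ S′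
... | yes refl = subst (_≤ W S) (sym (cong suc (occurrences-absent L S′∉L))) 1≤WS′
... | no _ = occurrences≤ W L unique 1≤W S

length≤∑ˢ : ∀ r (W : Subset r → ℕ) (L : List (Subset r)) → Unique L →
            All (λ S → 1 ≤ W S) L → length L ≤ ∑ˢ r W
length≤∑ˢ r W L unique 1≤W = begin
  length L                          ≡⟨ ∑ˢ-occurrences r L ⟨
  ∑ˢ r (λ S → occurrences S L)      ≤⟨ ∑ˢ-mono r (occurrences≤ W L unique 1≤W) ⟩
  ∑ˢ r W                            ∎
  where open ≤-Reasoning

-- Block counting

fourNotAll≤3 : ∀ a b c d → ¬ (T a × T b × T c × T d) → ⟦ a ⟧ + ⟦ b ⟧ + (⟦ c ⟧ + ⟦ d ⟧) ≤ 3
fourNotAll≤3 true true true true notAll = ⊥-elim (notAll _)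
fourNotAll≤3 false b c d _ = +-mono-≤ (⟦⟧≤1 b) (+-mono-≤ (⟦⟧≤1 c) (⟦⟧≤1 d))
fourNotAll≤3 true false c d _ = s≤s (+-mono-≤ (⟦⟧≤1 c) (⟦⟧≤1 d))
fourNotAll≤3 true true false d _ = s≤s (s≤s (⟦⟧≤1 d))
fourNotAll≤3 true true true false _ = ≤-refl

∑ᵇ²-notAll : ∀ b (g : Bool → Bool → Bool) → ¬ (∀ u v → T (g u v)) →
             ∑ᵇ (λ v → ∑ᵇ (λ u → ⟦ b ∧ g u v ⟧)) ≤ 3 * ⟦ b ⟧
∑ᵇ²-notAll false g _ = z≤n
∑ᵇ²-notAll true g notAll = fourNotAll≤3 (g false false) (g true false) (g false true) (g true true)
  λ (ff , tf , ft , tt) → notAll λ { false false → ff ; true false → tf ; false true → ft ; true true → tt }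

oneBlock : ∀ r (B G : Subset r → Bool) p q →
  (∀ S u v → B (fill p q S u v) ≡ B S) →
  (∀ S → ¬ (∀ u v → T (G (fill p q S u v)))) →
  4 * count (λ S → B S ∧ G S) ≤ 3 * count B
oneBlock r B G p q B-stable G-fails = begin
  4 * count (λ S → B S ∧ G S)                               ≡⟨ ∑ˢ-fill r H p q ⟨
  ∑ˢ r (λ S → ∑ᵇ (λ v → ∑ᵇ (λ u → H (fill p q S u v))))    ≤⟨ ∑ˢ-mono r refillings≤3 ⟩
  ∑ˢ r (λ S → 3 * ⟦ B S ⟧)                                   ≡⟨ ∑ˢ-*ˡ r 3 _ ⟩
  3 * count B                                                ∎
  where
  open ≤-Reasoning
  H : Subset r → ℕ
  H S = ⟦ B S ∧ G S ⟧
  stable : ∀ S u v → H (fill p q S u v) ≡ ⟦ B S ∧ G (fill p q S u v) ⟧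
  stable S u v = cong (λ b → ⟦ b ∧ G (fill p q S u v) ⟧) (B-stable S u v)
  refillings≤3 : ∀ S → ∑ᵇ (λ v → ∑ᵇ (λ u → H (fill p q S u v))) ≤ 3 * ⟦ B S ⟧
  refillings≤3 S = ≤-trans
    (≤-reflexive (cong₂ _+_ (cong₂ _+_ (stable S false false) (stable S true false))
                            (cong₂ _+_ (stable S false true) (stable S true true))))
    (∑ᵇ²-notAll (B S) (λ u v → G (fill p q S u v)) (G-fails S))

all-stable : ∀ {r} {D : Set} (G : D → Subset r → Bool) {S S′} ds →
  All (λ d → G d S′ ≡ G d S) ds → all (λ d → G d S′) ds ≡ all (λ d → G d S) ds
all-stable G [] [] = refl
all-stable G (d ∷ ds) (eq ∷ eqs) = cong₂ _∧_ eq (all-stable G ds eqs)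

blockBound : ∀ r {D : Set} (G : D → Subset r → Bool) (p q : D → Fin r) (ds : List D) →
  AllPairs (λ d d′ → ∀ S u v → G d′ (fill (p d) (q d) S u v) ≡ G d′ S) ds →
  All (λ d → ∀ S → ¬ (∀ u v → T (G d (fill (p d) (q d) S u v)))) ds →
  4 ^ length ds * count (λ S → all (λ d → G d S) ds) ≤ 3 ^ length ds * 2 ^ r
blockBound r G p q [] [] [] = ≤-reflexive (cong (1 *_) (trans (∑ˢ-const r 1) (*-identityʳ (2 ^ r))))
blockBound r G p q (d ∷ ds) (later-stable ∷ pairwise) (d-fails ∷ fails) = begin
  4 ^ suc k * count (λ S → G d S ∧ rest S) ≡⟨ cong (4 ^ suc k *_) (∑ˢ-cong r (λ S → cong ⟦_⟧ (∧-comm (G d S) (rest S)))) ⟩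
  4 * 4 ^ k * count (λ S → rest S ∧ G d S) ≡⟨ xy∙z≈y∙xz 4 (4 ^ k) _ ⟩
  4 ^ k * (4 * count (λ S → rest S ∧ G d S)) ≤⟨ *-monoʳ-≤ (4 ^ k) (oneBlock r rest (G d) (p d) (q d) rest-stable d-fails) ⟩
  4 ^ k * (3 * count rest)                   ≡⟨ x∙yz≈y∙xz (4 ^ k) 3 (count rest) ⟩
  3 * (4 ^ k * count rest)                   ≤⟨ *-monoʳ-≤ 3 (blockBound r G p q ds pairwise fails) ⟩
  3 * (3 ^ k * 2 ^ r)                        ≡⟨ *-assoc 3 (3 ^ k) (2 ^ r) ⟨
  3 ^ suc k * 2 ^ r                          ∎
  where
  open ≤-Reasoning
  k : ℕ
  k = length ds
  rest : Subset r → Bool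
  rest S = all (λ d′ → G d′ S) ds
  rest-stable : ∀ S u v → rest (fill (p d) (q d) S u v) ≡ rest S
  rest-stable S u v = all-stable G ds (Allₚ.map (λ stable → stable S u v) later-stable)

-- Greedy selection of a pairwise related sublist

module Greedy {A : Set} (R : A → A → Set) (R? : ∀ a b → Dec (R a b)) where

  greedy : List A → List A → List A
  greedy [] kept = kept
  greedy (g ∷ gs) kept with all? (R? g) kept
  ... | yes _ = greedy gs (g ∷ kept)
  ... | no _ = greedy gs kept

  greedy-pairwise : ∀ gs kept → AllPairs R kept → AllPairs R (greedy gs kept)
  greedy-pairwise [] kept pairwise = pairwise
  greedy-pairwise (g ∷ gs) kept pairwise with all? (R? g) kept
  ... | yes g-related = greedy-pairwise gs (g ∷ kept) (g-related ∷ pairwise)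
  ... | no _ = greedy-pairwise gs kept pairwise

  greedy-keeps : ∀ {P : A → Set} gs kept → Any P kept → Any P (greedy gs kept)
  greedy-keeps [] kept any = any
  greedy-keeps (g ∷ gs) kept any with all? (R? g) kept
  ... | yes _ = greedy-keeps gs (g ∷ kept) (there any)
  ... | no _ = greedy-keeps gs kept any

  greedy-maximal : ∀ gs kept {g} → g ∈ₗ gs → Any (λ d → g ≡ d ⊎ ¬ R g d) (greedy gs kept)
  greedy-maximal (g ∷ gs) kept (here refl) with all? (R? g) kept
  ... | yes _ = greedy-keeps gs (g ∷ kept) (here (inj₁ refl))
  ... | no unrelated = greedy-keeps gs kept (Anyₚ.map inj₂ (¬All⇒Any¬ (R? g) kept unrelated))
  greedy-maximal (g′ ∷ gs) kept (there g∈gs) with all? (R? g′) kept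
  ... | yes _ = greedy-maximal gs (g′ ∷ kept) g∈gs
  ... | no _ = greedy-maximal gs kept g∈gs

-- Counting ordered pairs

_<ᶠ_ : ∀ {n} → Fin n → Fin n → Bool
x <ᶠ y = toℕ x <ᵇ toℕ y

<ᶠ⇒≢ : ∀ {n} {x y : Fin n} → T (x <ᶠ y) → x ≢ y
<ᶠ⇒≢ {x = x} x<y refl = <-irrefl refl (<ᵇ⇒< (toℕ x) (toℕ x) x<y)

≢⇒<ᶠ⊎>ᶠ : ∀ {n} {x y : Fin n} → x ≢ y → T (x <ᶠ y) ⊎ T (y <ᶠ x)
≢⇒<ᶠ⊎>ᶠ {x = x} {y} x≢y with <-cmp (toℕ x) (toℕ y)
... | tri< x<y _ _ = inj₁ (<⇒<ᵇ x<y)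
... | tri≈ _ x≡y _ = ⊥-elim (x≢y (toℕ-injective x≡y))
... | tri> _ _ y<x = inj₂ (<⇒<ᵇ y<x)

pairs-count : ∀ n (P : Fin n → Bool) →
  sum (λ x → sum (λ y → ⟦ x <ᶠ y ∧ P x ∧ P y ⟧)) ≡ sum (⟦_⟧ ∘ P) C 2
pairs-count zero P = refl
pairs-count (suc n) P with P zero
... | true = begin
  s + sum (λ x → sum (λ y → ⟦ x <ᶠ y ∧ P (suc x) ∧ P (suc y) ⟧)) ≡⟨ cong (s +_) (pairs-count n (P ∘ suc)) ⟩
  s + s C 2                                                        ≡⟨ cong (_+ s C 2) (nC1≡n s) ⟨
  s C 1 + s C 2                                                    ≡⟨ nCk+nC[k+1]≡[n+1]C[k+1] s 1 ⟩
  suc s C 2                                                        ∎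
  where
  open ≡-Reasoning
  s : ℕ
  s = sum (⟦_⟧ ∘ P ∘ suc)
... | false = cong₂ _+_ (sum-zero n) (pairs-count n (P ∘ suc))

off-by-one : ∀ {a b} → a + 1 ≡ b + 0 → a + 0 ≡ b + 0 → ⊥
off-by-one {a} e₁ e₂ with +-cancelˡ-≡ a 1 0 (trans e₁ (sym e₂))
... | ()

disagreeing-changes : ∀ (X Y : Bool → Bool → ℕ) α β →
  (∀ u u′ v → X u v + ⟦ u′ ∧ v ⟧ ≡ X u′ v + ⟦ u ∧ v ⟧) →
  (∀ u v v′ → X u v + ⟦ u ∧ v′ ⟧ ≡ X u v′ + ⟦ u ∧ v ⟧) →
  (∀ u u′ v → Y u v + ⟦ u′ ∧ β ⟧ ≡ Y u′ v + ⟦ u ∧ β ⟧) →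
  (∀ u v v′ → Y u v + ⟦ α ∧ v′ ⟧ ≡ Y u v′ + ⟦ α ∧ v ⟧) →
  ¬ (∀ u v → X u v ≡ Y u v)
disagreeing-changes X Y α true X-u X-v Y-u Y-v X≡Y =
  off-by-one (Y-u false true false) (subst₂ (λ a b → a + 0 ≡ b + 0) (X≡Y false false) (X≡Y true false) (X-u false true false))
disagreeing-changes X Y true false X-u X-v Y-u Y-v X≡Y =
  off-by-one (Y-v false false true) (subst₂ (λ a b → a + 0 ≡ b + 0) (X≡Y false false) (X≡Y false true) (X-v false false true))
disagreeing-changes X Y false false X-u X-v Y-u Y-v X≡Y =
  off-by-one (X-v true false true) (subst₂ (λ a b → a + 0 ≡ b + 0) (sym (X≡Y true false)) (sym (X≡Y true true)) (Y-v true false true))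

-- From 4^k ℓ ≤ 3^k X and j ≤ 3k: 4^j ℓ³ ≤ 3^j X³, i.e. ℓ ≤ X (3/4)^(j/3).
cube-bound : ∀ ℓ X k j → 4 ^ k * ℓ ≤ 3 ^ k * X → j ≤ k * 3 → ℓ ^ 3 * 4 ^ j ≤ X ^ 3 * 3 ^ j
cube-bound ℓ X k j bound j≤3k with m≤n⇒∃[o]m+o≡n j≤3k
... | e , j+e≡3k = *-cancelʳ-≤ (ℓ ^ 3 * 4 ^ j) (X ^ 3 * 3 ^ j) (3 ^ e) {{m^n≢0 3 e}} (begin
  ℓ ^ 3 * 4 ^ j * 3 ^ e ≤⟨ *-monoʳ-≤ (ℓ ^ 3 * 4 ^ j) (^-monoˡ-≤ e (n≤1+n 3)) ⟩
  ℓ ^ 3 * 4 ^ j * 4 ^ e ≡⟨ as-cube 4 ℓ ⟩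
  (4 ^ k * ℓ) ^ 3       ≤⟨ ^-monoˡ-≤ 3 bound ⟩
  (3 ^ k * X) ^ 3       ≡⟨ as-cube 3 X ⟨
  X ^ 3 * 3 ^ j * 3 ^ e ∎)
  where
  open ≤-Reasoning
  as-cube : ∀ b a → a ^ 3 * b ^ j * b ^ e ≡ (b ^ k * a) ^ 3
  as-cube b a = begin-equality
    a ^ 3 * b ^ j * b ^ e   ≡⟨ *-assoc (a ^ 3) (b ^ j) (b ^ e) ⟩
    a ^ 3 * (b ^ j * b ^ e) ≡⟨ cong (a ^ 3 *_) (^-distribˡ-+-* b j e) ⟨
    a ^ 3 * b ^ (j + e)     ≡⟨ cong (λ t → a ^ 3 * b ^ t) j+e≡3k ⟩
    a ^ 3 * b ^ (k * 3)     ≡⟨ cong (a ^ 3 *_) (^-*-assoc b k 3) ⟨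
    a ^ 3 * (b ^ k) ^ 3     ≡⟨ *-comm (a ^ 3) ((b ^ k) ^ 3) ⟩
    (b ^ k) ^ 3 * a ^ 3     ≡⟨ ^-distrib-* (b ^ k) a 3 ⟨
    (b ^ k * a) ^ 3         ∎

-- The coset relation of a normal subgroup

module Cosets {r : ℕ} (G : FinGroup r) (N : Subset r) (N-normal : IsNormalSubgroup G N) where
  open FinGroup G public
  open IsNormalSubgroup N-normal public
  open IsGroup isGroup public using (assoc; identityˡ; identityʳ; inverseˡ)

  group : Group 0ℓ 0ℓ
  group = record { Carrier = Fin r ; _≈_ = _≡_ ; _∙_ = _∙_ ; ε = ε ; _⁻¹ = _⁻¹ ; isGroup = isGroup }
  open GroupProps group public
    using (⁻¹-involutive; ⁻¹-anti-homo-∙; ε⁻¹≈ε; ⁻¹-injective; ∙-cancelˡ; ∙-cancelʳ;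
           \\-leftDividesˡ; \\-leftDividesʳ; //-rightDividesˡ; //-rightDividesʳ)

  infix 4 _~_ _~?_

  _~_ : Fin r → Fin r → Set
  g ~ h = InCoset G N g h

  _~?_ : ∀ g h → Dec (g ~ h)
  g ~? h = (g ⁻¹ ∙ h) ∈? N

  ~-refl : ∀ g → g ~ g
  ~-refl g = subst (_∈ N) (sym (inverseˡ g)) ε∈N

  ~-sym : ∀ {g h} → g ~ h → h ~ g
  ~-sym {g} {h} g~h = subst (_∈ N) inverse-of-quotient (⁻¹-closed g~h)
    where
    inverse-of-quotient : (g ⁻¹ ∙ h) ⁻¹ ≡ h ⁻¹ ∙ g
    inverse-of-quotient = trans (⁻¹-anti-homo-∙ (g ⁻¹) h) (cong (h ⁻¹ ∙_) (⁻¹-involutive g))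

  ~-trans : ∀ {g h k} → g ~ h → h ~ k → g ~ k
  ~-trans {g} {h} {k} g~h h~k = subst (_∈ N) telescope (∙-closed g~h h~k)
    where
    telescope : (g ⁻¹ ∙ h) ∙ (h ⁻¹ ∙ k) ≡ g ⁻¹ ∙ k
    telescope = trans (assoc (g ⁻¹) h (h ⁻¹ ∙ k)) (cong (g ⁻¹ ∙_) (\\-leftDividesˡ h k))

  left-quotient : ∀ a g h → (a ∙ g) ⁻¹ ∙ (a ∙ h) ≡ g ⁻¹ ∙ h
  left-quotient a g h = begin
    (a ∙ g) ⁻¹ ∙ (a ∙ h)    ≡⟨ cong (_∙ (a ∙ h)) (⁻¹-anti-homo-∙ a g) ⟩
    (g ⁻¹ ∙ a ⁻¹) ∙ (a ∙ h) ≡⟨ assoc (g ⁻¹) (a ⁻¹) (a ∙ h) ⟩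
    g ⁻¹ ∙ (a ⁻¹ ∙ (a ∙ h)) ≡⟨ cong (g ⁻¹ ∙_) (\\-leftDividesʳ a h) ⟩
    g ⁻¹ ∙ h                ∎
    where open ≡-Reasoning

  ~-left : ∀ a {g h} → g ~ h → a ∙ g ~ a ∙ h
  ~-left a {g} {h} = subst (_∈ N) (sym (left-quotient a g h))

  ~-left⁻ : ∀ a {g h} → a ∙ g ~ a ∙ h → g ~ h
  ~-left⁻ a {g} {h} = subst (_∈ N) (left-quotient a g h)

  ~-right : ∀ z {g h} → g ~ h → g ∙ z ~ h ∙ z
  ~-right z {g} {h} g~h = subst (_∈ N) conjugate (normal (z ⁻¹) g~h)
    where
    open ≡-Reasoning
    conjugate : z ⁻¹ ∙ (g ⁻¹ ∙ h) ∙ z ⁻¹ ⁻¹ ≡ (g ∙ z) ⁻¹ ∙ (h ∙ z)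
    conjugate = begin
      z ⁻¹ ∙ (g ⁻¹ ∙ h) ∙ z ⁻¹ ⁻¹ ≡⟨ cong (z ⁻¹ ∙ (g ⁻¹ ∙ h) ∙_) (⁻¹-involutive z) ⟩
      z ⁻¹ ∙ (g ⁻¹ ∙ h) ∙ z       ≡⟨ cong (_∙ z) (assoc (z ⁻¹) (g ⁻¹) h) ⟨
      z ⁻¹ ∙ g ⁻¹ ∙ h ∙ z         ≡⟨ assoc (z ⁻¹ ∙ g ⁻¹) h z ⟩
      (z ⁻¹ ∙ g ⁻¹) ∙ (h ∙ z)     ≡⟨ cong (_∙ (h ∙ z)) (⁻¹-anti-homo-∙ g z) ⟨
      (g ∙ z) ⁻¹ ∙ (h ∙ z)        ∎

  ~-right⁻ : ∀ z {g h} → g ∙ z ~ h ∙ z → g ~ h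
  ~-right⁻ z {g} {h} gz~hz = subst₂ _~_ (//-rightDividesʳ z g) (//-rightDividesʳ z h) (~-right (z ⁻¹) gz~hz)

  -- Inversion respects the relation (left and right cosets of N coincide).
  ~-inverse : ∀ {g h} → g ~ h → g ⁻¹ ~ h ⁻¹
  ~-inverse {g} {h} g~h = ~-sym (subst (_∈ N) conjugate (normal g g~h))
    where
    conjugate : g ∙ (g ⁻¹ ∙ h) ∙ g ⁻¹ ≡ h ⁻¹ ⁻¹ ∙ g ⁻¹
    conjugate = cong (_∙ g ⁻¹) (trans (\\-leftDividesˡ g h) (sym (⁻¹-involutive h)))

  ε~⇒∈N : ∀ {g} → ε ~ g → g ∈ N
  ε~⇒∈N {g} = subst (_∈ N) (trans (cong (_∙ g) ε⁻¹≈ε) (identityˡ g))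

-- Common out-neighbours of 1 and z inside a coset

module CommonNeighbours {r : ℕ} (G : FinGroup r) (N : Subset r) (N-normal : IsNormalSubgroup G N)
                        (c : Fin r) (c∉N : c ∉ N) where
  open Cosets G N N-normal

  coset-distinct : ∀ {d a b} → d ~ a → d ∙ c ⁻¹ ~ b → a ≢ b
  coset-distinct {d} d~a dc⁻¹~a refl = c∉N (subst (_∈ N) (⁻¹-involutive c) (⁻¹-closed c⁻¹∈N))
    where
    c⁻¹∈N : c ⁻¹ ∈ N
    c⁻¹∈N = ε~⇒∈N (~-left⁻ d (subst (_~ d ∙ c ⁻¹) (sym (identityʳ d)) (~-trans d~a (~-sym dc⁻¹~a))))

  shift : ∀ {z d w} → c ~ z → d ~ w → d ∙ c ⁻¹ ~ w ∙ z ⁻¹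
  shift {z} {d} {w} c~z d~w = ~-trans (~-right (c ⁻¹) d~w) (~-left w (~-inverse c~z))

  inCoset : Fin r → Fin r → Bool
  inCoset d w = isYes (d ~? w)

  -- w ∈ dN receives arcs both from 1 (w ∈ S) and from z (w z⁻¹ ∈ S) in Γ(R,S).
  commonAt : Fin r → Fin r → Subset r → Fin r → Bool
  commonAt z d S w = inCoset d w ∧ lookup S w ∧ lookup S (w ∙ z ⁻¹)

  common : Fin r → Fin r → Subset r → ℕ
  common z d S = sum (λ w → ⟦ commonAt z d S w ⟧)

  commonAt-elim : ∀ z d S w → T (commonAt z d S w) → d ~ w × T (lookup S w) × T (lookup S (w ∙ z ⁻¹))
  commonAt-elim z d S w t with ∧³-elim {inCoset d w} {lookup S w} {lookup S (w ∙ z ⁻¹)} t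
  ... | d~w , w∈S , z→w = toWitness d~w , w∈S , z→w

  commonAt-intro : ∀ z d S w → d ~ w → T (lookup S w) → T (lookup S (w ∙ z ⁻¹)) → T (commonAt z d S w)
  commonAt-intro z d S w d~w = ∧³-intro (fromWitness {a? = d ~? w} d~w)

  commonAt-inside : ∀ {z d w} S → d ~ w → commonAt z d S w ≡ lookup S w ∧ lookup S (w ∙ z ⁻¹)
  commonAt-inside {z} {d} {w} S d~w =
    cong (_∧ (lookup S w ∧ lookup S (w ∙ z ⁻¹))) (to T-≡ (fromWitness {a? = d ~? w} d~w))

  w∙ε⁻¹≡w : ∀ w → w ∙ ε ⁻¹ ≡ w
  w∙ε⁻¹≡w w = trans (cong (w ∙_) ε⁻¹≈ε) (identityʳ w)

  ∈⇒arc-from-ε : ∀ {S w} → T (lookup S w) → Arc G S ε w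
  ∈⇒arc-from-ε {S} {w} w∈S =
    subst (_∈ S) (sym (w∙ε⁻¹≡w w)) (Vecₚ.lookup⇒[]= w S (to T-≡ w∈S))

  arc-from-ε⇒∈ : ∀ {S w} → Arc G S ε w → T (lookup S w)
  arc-from-ε⇒∈ {S} {w} arc =
    from T-≡ (Vecₚ.[]=⇒lookup (subst (_∈ S) (w∙ε⁻¹≡w w) arc))

  arc⇒lookup : ∀ {S z w} → Arc G S z w → T (lookup S (w ∙ z ⁻¹))
  arc⇒lookup arc = from T-≡ (Vecₚ.[]=⇒lookup arc)

  lookup⇒arc : ∀ {S z w} → T (lookup S (w ∙ z ⁻¹)) → Arc G S z w
  lookup⇒arc {S} {z} {w} t = Vecₚ.lookup⇒[]= (w ∙ z ⁻¹) S (to T-≡ t)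

  -- An automorphism in F_S that fixes 1 and sends x to y maps the common out-neighbours
  -- of 1 and x in dN bijectively onto those of 1 and y (it fixes dN setwise).
  common-invariant : ∀ S f → InF G N S f → f ⟨$⟩ʳ ε ≡ ε → ∀ x d → common x d S ≡ common (f ⟨$⟩ʳ x) d S
  common-invariant S f (aut , fixes) f1≡1 x d = count-bijection (commonAt x d S) (commonAt y d S) f forward backward
    where
    y : Fin r
    y = f ⟨$⟩ʳ x
    forward : ∀ w → T (commonAt x d S w) → T (commonAt y d S (f ⟨$⟩ʳ w))
    forward w t with commonAt-elim x d S w t
    ... | d~w , w∈S , x→w = commonAt-intro y d S (f ⟨$⟩ʳ w)
      (proj₁ (fixes d w d~w))
      (arc-from-ε⇒∈ (subst (λ o → Arc G S o (f ⟨$⟩ʳ w)) f1≡1 (to (aut ε w) (∈⇒arc-from-ε w∈S))))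
      (arc⇒lookup (to (aut x w) (lookup⇒arc x→w)))
    backward : ∀ w → T (commonAt y d S w) → T (commonAt x d S (f ⟨$⟩ˡ w))
    backward w t with commonAt-elim y d S w t
    ... | d~w , w∈S , y→w = commonAt-intro x d S (f ⟨$⟩ˡ w)
      (proj₂ (fixes d w d~w))
      (arc-from-ε⇒∈ (from (aut ε w′) (subst₂ (Arc G S) (sym f1≡1) (sym fw′≡w) (∈⇒arc-from-ε w∈S))))
      (arc⇒lookup (from (aut x w′) (subst (Arc G S y) (sym fw′≡w) (lookup⇒arc y→w))))
      where
      w′ : Fin r
      w′ = f ⟨$⟩ˡ w
      fw′≡w : f ⟨$⟩ʳ w′ ≡ w
      fw′≡w = inverseʳ f

  -- The region read by common z d when z ∈ cN: the two cosets dN and dc⁻¹N.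
  Near : Fin r → Fin r → Set
  Near d t = d ~ t ⊎ d ∙ c ⁻¹ ~ t

  common-local : ∀ {z} d {S S′} → c ~ z → (∀ t → Near d t → lookup S t ≡ lookup S′ t) →
                 common z d S ≡ common z d S′
  common-local {z} d c~z same = sum-cong-≗ λ w → cong ⟦_⟧ (∧-cong-T (inCoset d w) λ d∋w →
    let d~w = toWitness {a? = d ~? w} d∋w in
    cong₂ _∧_ (same w (inj₁ d~w)) (same (w ∙ z ⁻¹) (inj₂ (shift c~z d~w))))

  common-pointChange : ∀ z d {S S′} t w₀ → (∀ t′ → t′ ≢ t → lookup S t′ ≡ lookup S′ t′) →
    (∀ w → d ~ w → w ≡ t ⊎ w ∙ z ⁻¹ ≡ t → w ≡ w₀) →
    common z d S + ⟦ commonAt z d S′ w₀ ⟧ ≡ common z d S′ + ⟦ commonAt z d S w₀ ⟧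
  common-pointChange z d {S} {S′} t w₀ same only-w₀ =
    sum-pointChange (⟦_⟧ ∘ commonAt z d S) (⟦_⟧ ∘ commonAt z d S′) w₀ λ w w≢w₀ →
      cong ⟦_⟧ (∧-cong-T (inCoset d w) λ d∋w → let d~w = toWitness {a? = d ~? w} d∋w in
        cong₂ _∧_ (same w (λ w≡t → w≢w₀ (only-w₀ w d~w (inj₁ w≡t))))
                  (same (w ∙ z ⁻¹) (λ wz⁻¹≡t → w≢w₀ (only-w₀ w d~w (inj₂ wz⁻¹≡t)))))

  agrees : Fin r → Fin r → Fin r → Subset r → Bool
  agrees x y d S = isYes (common x d S ≟ common y d S)

  -- For distinct x, y ∈ cN put q = dx⁻¹ ∈ dc⁻¹N and e = qy ∈ dN.
  -- Refilling the entries d and q of S with u and v changes common x d only through the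
  -- element d (contributing u ∧ v), but common y d through d (contributing u ∧ [dy⁻¹ ∈ S])
  -- and through e (contributing [e ∈ S] ∧ v); so the counts cannot agree for all four fillings.
  module FourFillings {x y} (c~x : c ~ x) (c~y : c ~ y) (x≢y : x ≢ y) (d : Fin r) (S : Subset r) where
    q e : Fin r
    q = d ∙ x ⁻¹
    e = q ∙ y

    S′ : Bool → Bool → Subset r
    S′ = fill d q S

    dc⁻¹~q : d ∙ c ⁻¹ ~ q
    dc⁻¹~q = shift c~x (~-refl d)

    d~e : d ~ e
    d~e = subst (_~ e) (//-rightDividesˡ x d) (~-left q (~-trans (~-sym c~x) c~y))

    d≢q : d ≢ q
    d≢q = coset-distinct (~-refl d) dc⁻¹~q

    dy⁻¹≢d : d ∙ y ⁻¹ ≢ d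
    dy⁻¹≢d = coset-distinct (~-refl d) (shift c~y (~-refl d)) ∘ sym

    dy⁻¹≢q : d ∙ y ⁻¹ ≢ q
    dy⁻¹≢q dy⁻¹≡dx⁻¹ = x≢y (⁻¹-injective (sym (∙-cancelˡ d (y ⁻¹) (x ⁻¹) dy⁻¹≡dx⁻¹)))

    e≢d : e ≢ d
    e≢d e≡d = dy⁻¹≢q (sym (∙-cancelʳ y q (d ∙ y ⁻¹) (trans e≡d (sym (//-rightDividesˡ y d)))))

    e≢q : e ≢ q
    e≢q = coset-distinct d~e dc⁻¹~q

    at-d-for-x : ∀ u v → commonAt x d (S′ u v) d ≡ u ∧ v
    at-d-for-x u v = trans (commonAt-inside (S′ u v) (~-refl d))
                           (cong₂ _∧_ (fill-p d q S u v) (fill-q S u v d≢q))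

    at-d-for-y : ∀ u v → commonAt y d (S′ u v) d ≡ u ∧ lookup S (d ∙ y ⁻¹)
    at-d-for-y u v = trans (commonAt-inside (S′ u v) (~-refl d))
                           (cong₂ _∧_ (fill-p d q S u v) (fill-elsewhere S u v dy⁻¹≢d dy⁻¹≢q))

    at-e-for-y : ∀ u v → commonAt y d (S′ u v) e ≡ lookup S e ∧ v
    at-e-for-y u v = trans (commonAt-inside (S′ u v) d~e)
      (cong₂ _∧_ (fill-elsewhere S u v e≢d e≢q)
                 (trans (cong (lookup (S′ u v)) (//-rightDividesʳ y q)) (fill-q S u v d≢q)))

    only-d-reads-d : ∀ {z} → c ~ z → ∀ w → d ~ w → w ≡ d ⊎ w ∙ z ⁻¹ ≡ d → w ≡ d
    only-d-reads-d c~z w d~w (inj₁ w≡d) = w≡d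
    only-d-reads-d c~z w d~w (inj₂ wz⁻¹≡d) = ⊥-elim (coset-distinct (~-refl d) (shift c~z d~w) (sym wz⁻¹≡d))

    only-d-reads-q : ∀ w → d ~ w → w ≡ q ⊎ w ∙ x ⁻¹ ≡ q → w ≡ d
    only-d-reads-q w d~w (inj₁ w≡q) = ⊥-elim (coset-distinct d~w dc⁻¹~q w≡q)
    only-d-reads-q w d~w (inj₂ wx⁻¹≡q) = ∙-cancelʳ (x ⁻¹) w d wx⁻¹≡q

    only-e-reads-q : ∀ w → d ~ w → w ≡ q ⊎ w ∙ y ⁻¹ ≡ q → w ≡ e
    only-e-reads-q w d~w (inj₁ w≡q) = ⊥-elim (coset-distinct d~w dc⁻¹~q w≡q)
    only-e-reads-q w d~w (inj₂ wy⁻¹≡q) = trans (sym (//-rightDividesˡ y w)) (cong (_∙ y) wy⁻¹≡q)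

    X Y : Bool → Bool → ℕ
    X u v = common x d (S′ u v)
    Y u v = common y d (S′ u v)

    X-u : ∀ u u′ v → X u v + ⟦ u′ ∧ v ⟧ ≡ X u′ v + ⟦ u ∧ v ⟧
    X-u u u′ v = subst₂ (λ a b → X u v + ⟦ a ⟧ ≡ X u′ v + ⟦ b ⟧) (at-d-for-x u′ v) (at-d-for-x u v)
      (common-pointChange x d {S′ u v} {S′ u′ v} d d (λ t t≢d → fill-vary-u S u u′ v t≢d) (only-d-reads-d c~x))

    X-v : ∀ u v v′ → X u v + ⟦ u ∧ v′ ⟧ ≡ X u v′ + ⟦ u ∧ v ⟧
    X-v u v v′ = subst₂ (λ a b → X u v + ⟦ a ⟧ ≡ X u v′ + ⟦ b ⟧) (at-d-for-x u v′) (at-d-for-x u v)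
      (common-pointChange x d {S′ u v} {S′ u v′} q d (λ t t≢q → fill-vary-v S u v v′ t≢q) only-d-reads-q)

    Y-u : ∀ u u′ v → Y u v + ⟦ u′ ∧ lookup S (d ∙ y ⁻¹) ⟧ ≡ Y u′ v + ⟦ u ∧ lookup S (d ∙ y ⁻¹) ⟧
    Y-u u u′ v = subst₂ (λ a b → Y u v + ⟦ a ⟧ ≡ Y u′ v + ⟦ b ⟧) (at-d-for-y u′ v) (at-d-for-y u v)
      (common-pointChange y d {S′ u v} {S′ u′ v} d d (λ t t≢d → fill-vary-u S u u′ v t≢d) (only-d-reads-d c~y))

    Y-v : ∀ u v v′ → Y u v + ⟦ lookup S e ∧ v′ ⟧ ≡ Y u v′ + ⟦ lookup S e ∧ v ⟧
    Y-v u v v′ = subst₂ (λ a b → Y u v + ⟦ a ⟧ ≡ Y u v′ + ⟦ b ⟧) (at-e-for-y u v′) (at-e-for-y u v)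
      (common-pointChange y d {S′ u v} {S′ u v′} q e (λ t t≢q → fill-vary-v S u v v′ t≢q) only-e-reads-q)

    not-all-agree : ¬ (∀ u v → T (agrees x y d (S′ u v)))
    not-all-agree all-agree = disagreeing-changes X Y (lookup S e) (lookup S (d ∙ y ⁻¹)) X-u X-v Y-u Y-v
      (λ u v → toWitness (all-agree u v))

  -- d and d′ are apart when the regions dN ∪ dc⁻¹N and d′N ∪ d′c⁻¹N are disjoint.
  Apart : Fin r → Fin r → Set
  Apart d d′ = ¬ d ~ d′ × ¬ d ~ d′ ∙ c ⁻¹ × ¬ d ∙ c ⁻¹ ~ d′

  Apart? : ∀ d d′ → Dec (Apart d d′)
  Apart? d d′ = ¬? (d ~? d′) ×-dec ¬? (d ~? d′ ∙ c ⁻¹) ×-dec ¬? (d ∙ c ⁻¹ ~? d′)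

  apart-disjoint : ∀ {d d′ t} → Apart d d′ → Near d t → ¬ Near d′ t
  apart-disjoint (d≁d′ , _ , _) (inj₁ d~t) (inj₁ d′~t) = d≁d′ (~-trans d~t (~-sym d′~t))
  apart-disjoint (_ , d≁d′c⁻¹ , _) (inj₁ d~t) (inj₂ d′c⁻¹~t) = d≁d′c⁻¹ (~-trans d~t (~-sym d′c⁻¹~t))
  apart-disjoint (_ , _ , dc⁻¹≁d′) (inj₂ dc⁻¹~t) (inj₁ d′~t) = dc⁻¹≁d′ (~-trans dc⁻¹~t (~-sym d′~t))
  apart-disjoint (d≁d′ , _ , _) (inj₂ dc⁻¹~t) (inj₂ d′c⁻¹~t) =
    d≁d′ (~-right⁻ (c ⁻¹) (~-trans dc⁻¹~t (~-sym d′c⁻¹~t)))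

  -- The entries d and dx⁻¹ refilled for d lie near d, so refilling them does not affect
  -- agreement at any d′ apart from d.
  agrees-stable : ∀ {x y d d′} → c ~ x → c ~ y → Apart d d′ →
                  ∀ S u v → agrees x y d′ (fill d (d ∙ x ⁻¹) S u v) ≡ agrees x y d′ S
  agrees-stable {x} {y} {d} {d′} c~x c~y apart S u v =
    cong₂ (λ m n → isYes (m ≟ n)) (common-local d′ {fill d (d ∙ x ⁻¹) S u v} {S} c~x unchanged)
                                  (common-local d′ {fill d (d ∙ x ⁻¹) S u v} {S} c~y unchanged)
    where
    unchanged : ∀ t → Near d′ t → lookup (fill d (d ∙ x ⁻¹) S u v) t ≡ lookup S t
    unchanged t near-d′ = fill-elsewhere S u v
      (λ { refl → apart-disjoint apart (inj₁ (~-refl d)) near-d′ })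
      (λ { refl → apart-disjoint apart (inj₂ (shift c~x (~-refl d))) near-d′ })

  open Greedy Apart Apart? using (greedy; greedy-pairwise; greedy-maximal)

  representatives : List (Fin r)
  representatives = greedy (allFin r) []

  near³ : Fin r → Fin r → Bool
  near³ d g = inCoset d g ∨ inCoset (d ∙ c ⁻¹) g ∨ inCoset (d ∙ c) g

  near³-unless-apart : ∀ {g d} → g ≡ d ⊎ ¬ Apart g d → T (near³ d g)
  near³-unless-apart {g} (inj₁ refl) = T-∨ˡ (fromWitness {a? = g ~? g} (~-refl g))
  near³-unless-apart {g} {d} (inj₂ not-apart) with g ~? d | g ~? d ∙ c ⁻¹ | g ∙ c ⁻¹ ~? d
  ... | yes g~d | _ | _ = T-∨ˡ (fromWitness {a? = d ~? g} (~-sym g~d))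
  ... | no _ | yes g~dc⁻¹ | _ = T-∨ʳ {inCoset d g} (T-∨ˡ (fromWitness {a? = d ∙ c ⁻¹ ~? g} (~-sym g~dc⁻¹)))
  ... | no _ | no _ | yes gc⁻¹~d = T-∨ʳ {inCoset d g} (T-∨ʳ {inCoset (d ∙ c ⁻¹) g} (fromWitness {a? = d ∙ c ~? g}
          (~-sym (subst (_~ d ∙ c) (//-rightDividesˡ c g) (~-right c gc⁻¹~d)))))
  ... | no g≁d | no g≁dc⁻¹ | no gc⁻¹≁d = ⊥-elim (not-apart (g≁d , g≁dc⁻¹ , gc⁻¹≁d))

  -- By maximality of the greedy choice, the representatives cover R with 3 cosets each.
  representatives-cover : ∀ g → Any (λ d → T (near³ d g)) representatives
  representatives-cover g = Anyₚ.map near³-unless-apart (greedy-maximal (allFin r) [] (∈-allFin g))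

  coset-size : ∀ a → sum (⟦_⟧ ∘ inCoset a) ≡ ∣ N ∣
  coset-size a = begin
    sum (⟦_⟧ ∘ inCoset a)                   ≡⟨ sum-permute (⟦_⟧ ∘ inCoset a) left-translation ⟩
    sum (λ h → ⟦ inCoset a (a ∙ h) ⟧)       ≡⟨ sum-cong-≗ (λ h → cong (λ g → ⟦ isYes (g ∈? N) ⟧) (\\-leftDividesʳ a h)) ⟩
    sum (λ h → ⟦ isYes (h ∈? N) ⟧)          ≡⟨ ∣∣≡count N ⟩
    ∣ N ∣                                   ∎
    where
    open ≡-Reasoning
    left-translation : Permutation′ r
    left-translation = permutation (a ∙_) (a ⁻¹ ∙_) (\\-leftDividesˡ a) (\\-leftDividesʳ a)

  k : ℕ
  k = length representatives

  r≤k*3*|N| : r ≤ k * 3 * ∣ N ∣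
  r≤k*3*|N| = begin
    r                                                        ≡⟨ trans (sum-const r 1) (*-identityʳ r) ⟨
    sum {r} (λ _ → 1)                                        ≤⟨ sum-mono (λ g → ⟦⟧-true (any⁺ (λ d → near³ d g) (representatives-cover g))) ⟩
    sum (λ g → ⟦ any (λ d → near³ d g) representatives ⟧)  ≤⟨ union-count near³ representatives near³-size ⟩
    k * (∣ N ∣ + (∣ N ∣ + (∣ N ∣ + 0)))                    ≡⟨ *-assoc k 3 ∣ N ∣ ⟨
    k * 3 * ∣ N ∣                                            ∎
    where
    open ≤-Reasoning
    near³-size : ∀ d → sum (⟦_⟧ ∘ near³ d) ≤ ∣ N ∣ + (∣ N ∣ + (∣ N ∣ + 0))
    near³-size d = begin
      sum (⟦_⟧ ∘ near³ d)
        ≤⟨ sum-mono (λ g → ≤-trans (⟦∨⟧≤ (inCoset d g) _) (+-monoʳ-≤ ⟦ inCoset d g ⟧ (⟦∨⟧≤ (inCoset (d ∙ c ⁻¹) g) _))) ⟩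
      sum (λ g → ⟦ inCoset d g ⟧ + (⟦ inCoset (d ∙ c ⁻¹) g ⟧ + ⟦ inCoset (d ∙ c) g ⟧))
        ≡⟨ trans (∑-distrib-+ (⟦_⟧ ∘ inCoset d) (λ g → ⟦ inCoset (d ∙ c ⁻¹) g ⟧ + ⟦ inCoset (d ∙ c) g ⟧))
                 (cong (sum (⟦_⟧ ∘ inCoset d) +_) (∑-distrib-+ (⟦_⟧ ∘ inCoset (d ∙ c ⁻¹)) (⟦_⟧ ∘ inCoset (d ∙ c)))) ⟩
      sum (⟦_⟧ ∘ inCoset d) + (sum (⟦_⟧ ∘ inCoset (d ∙ c ⁻¹)) + sum (⟦_⟧ ∘ inCoset (d ∙ c)))
        ≡⟨ cong₂ _+_ (coset-size d) (cong₂ _+_ (coset-size (d ∙ c ⁻¹)) (coset-size (d ∙ c))) ⟩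
      ∣ N ∣ + (∣ N ∣ + ∣ N ∣)
        ≡⟨ cong (λ t → ∣ N ∣ + (∣ N ∣ + t)) (+-identityʳ ∣ N ∣) ⟨
      ∣ N ∣ + (∣ N ∣ + (∣ N ∣ + 0)) ∎

  index≤3k : ∀ m → m * ∣ N ∣ ≡ r → m ≤ k * 3
  index≤3k m m*n≡r = *-cancelʳ-≤ m (k * 3) ∣ N ∣ {{>-nonZero |N|>0}} (≤-trans (≤-reflexive m*n≡r) r≤k*3*|N|)
    where
    |N|>0 : 0 < ∣ N ∣
    |N|>0 = ≤-trans (⟦⟧-true (fromWitness {a? = c ~? c} (~-refl c)))
                    (≤-trans (term≤sum (⟦_⟧ ∘ inCoset c) c) (≤-reflexive (coset-size c)))

  pairInC : Fin r → Fin r → Bool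
  pairInC x y = x <ᶠ y ∧ inCoset c x ∧ inCoset c y

  agreeAll : Fin r → Fin r → Subset r → Bool
  agreeAll x y S = all (λ d → agrees x y d S) representatives

  agreeAll-count : ∀ {x y} → c ~ x → c ~ y → x ≢ y → 4 ^ k * count (agreeAll x y) ≤ 3 ^ k * 2 ^ r
  agreeAll-count {x} {y} c~x c~y x≢y = blockBound r (agrees x y) (λ d → d) (λ d → d ∙ x ⁻¹) representatives
    (AllPairsₚ.map (agrees-stable c~x c~y) (greedy-pairwise (allFin r) [] []))
    (Allₚ.tabulate λ {d} _ → FourFillings.not-all-agree c~x c~y x≢y d)

  pair-count : ∀ x y → 4 ^ k * count (λ S → pairInC x y ∧ agreeAll x y S) ≤ (3 ^ k * 2 ^ r) * ⟦ pairInC x y ⟧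
  pair-count x y = begin
    4 ^ k * count (λ S → pairInC x y ∧ agreeAll x y S)   ≡⟨ cong (4 ^ k *_) (count-guarded r (pairInC x y) (agreeAll x y)) ⟩
    4 ^ k * (count (agreeAll x y) * ⟦ pairInC x y ⟧)     ≡⟨ *-assoc (4 ^ k) _ _ ⟨
    4 ^ k * count (agreeAll x y) * ⟦ pairInC x y ⟧       ≤⟨ ⟦⟧-scale (pairInC x y) pair-bound ⟩
    (3 ^ k * 2 ^ r) * ⟦ pairInC x y ⟧                    ∎
    where
    open ≤-Reasoning
    pair-bound : T (pairInC x y) → 4 ^ k * count (agreeAll x y) ≤ 3 ^ k * 2 ^ r
    pair-bound t with ∧³-elim {x <ᶠ y} {inCoset c x} {inCoset c y} t
    ... | x<y , c∋x , c∋y = agreeAll-count (toWitness {a? = c ~? x} c∋x) (toWitness {a? = c ~? y} c∋y) (<ᶠ⇒≢ x<y)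

  pairs : Subset r → ℕ
  pairs S = sum (λ x → sum (λ y → ⟦ pairInC x y ∧ agreeAll x y S ⟧))

  agreeAll-intro : ∀ {x y S} → (∀ d → common x d S ≡ common y d S) → T (agreeAll x y S)
  agreeAll-intro {x} {y} {S} agreement = all⁻ (λ d → agrees x y d S) {xs = representatives}
    (Allₚ.tabulate λ {d} _ → fromWitness {a? = common x d S ≟ common y d S} (agreement d))

  pair-weight : ∀ S x y → T (pairInC x y) → T (agreeAll x y S) → 1 ≤ pairs S
  pair-weight S x y xy∈C agree = ≤-trans (⟦⟧-true (from T-∧ (xy∈C , agree)))
    (≤-trans (term≤sum (λ y′ → ⟦ pairInC x y′ ∧ agreeAll x y′ S ⟧) y)
             (term≤sum (λ x′ → sum (λ y′ → ⟦ pairInC x′ y′ ∧ agreeAll x′ y′ S ⟧)) x))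

  -- A subset counted in the lemma has a pair: an automorphism f ∈ F_S fixing 1 and moving
  -- x ∈ cN gives agreeing x and y = f x ∈ cN, in one of the two orders.
  bad⇒pair : ∀ S → Bad G N c S → 1 ≤ pairs S
  bad⇒pair S (f , inF@(_ , fixes) , f1≡1 , x , c~x , fx≢x) = ordered (≢⇒<ᶠ⊎>ᶠ (fx≢x ∘ sym))
    where
    y : Fin r
    y = f ⟨$⟩ʳ x
    c∋x : T (inCoset c x)
    c∋x = fromWitness {a? = c ~? x} c~x
    c∋y : T (inCoset c y)
    c∋y = fromWitness {a? = c ~? y} (proj₁ (fixes c x c~x))
    agreement : ∀ d → common x d S ≡ common y d S
    agreement = common-invariant S f inF f1≡1 x
    ordered : T (x <ᶠ y) ⊎ T (y <ᶠ x) → 1 ≤ pairs S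
    ordered (inj₁ x<y) = pair-weight S x y (∧³-intro x<y c∋x c∋y) (agreeAll-intro {x} {y} {S} agreement)
    ordered (inj₂ y<x) = pair-weight S y x (∧³-intro y<x c∋y c∋x) (agreeAll-intro {y} {x} {S} (sym ∘ agreement))

  bad-count : ∀ L → Unique L → All (Bad G N c) L → 4 ^ k * length L ≤ 3 ^ k * (2 ^ r * (∣ N ∣ C 2))
  bad-count L unique bads = begin
    4 ^ k * length L
      ≤⟨ *-monoʳ-≤ (4 ^ k) (length≤∑ˢ r pairs L unique (Allₚ.map (bad⇒pair _) bads)) ⟩
    4 ^ k * ∑ˢ r pairs
      ≡⟨ cong (4 ^ k *_) (trans (∑ˢ-sum r (λ x S → sum (λ y → ⟦ pairInC x y ∧ agreeAll x y S ⟧)))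
                                (sum-cong-≗ λ x → ∑ˢ-sum r (λ y S → ⟦ pairInC x y ∧ agreeAll x y S ⟧))) ⟩
    4 ^ k * sum (λ x → sum (λ y → count (λ S → pairInC x y ∧ agreeAll x y S)))
      ≡⟨ *-distrib-sum² (4 ^ k) (λ x y → count (λ S → pairInC x y ∧ agreeAll x y S)) ⟩
    sum (λ x → sum (λ y → 4 ^ k * count (λ S → pairInC x y ∧ agreeAll x y S)))
      ≤⟨ sum-mono (λ x → sum-mono (λ y → pair-count x y)) ⟩
    sum (λ x → sum (λ y → (3 ^ k * 2 ^ r) * ⟦ pairInC x y ⟧))
      ≡⟨ *-distrib-sum² (3 ^ k * 2 ^ r) (λ x y → ⟦ pairInC x y ⟧) ⟨
    (3 ^ k * 2 ^ r) * sum (λ x → sum (λ y → ⟦ pairInC x y ⟧))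
      ≡⟨ cong ((3 ^ k * 2 ^ r) *_) (trans (pairs-count r (inCoset c)) (cong (_C 2) (coset-size c))) ⟩
    (3 ^ k * 2 ^ r) * (∣ N ∣ C 2)
      ≡⟨ *-assoc (3 ^ k) (2 ^ r) (∣ N ∣ C 2) ⟩
    3 ^ k * (2 ^ r * (∣ N ∣ C 2)) ∎
    where open ≤-Reasoning

lemma2p3 : (r : ℕ) (G : FinGroup r) (N : Subset r) →
    IsNormalSubgroup G N →
    ∃ (λ x → x ∈ N × ¬ (x ≡ FinGroup.ε G)) →
    ∃ (λ x → x ∉ N) →
    (m : ℕ) → m * ∣ N ∣ ≡ r →
    (c : Fin r) → c ∉ N →
    (L : List (Subset r)) → Unique L → All (Bad G N c) L →
    length L ^ 3 * 4 ^ (m ∸ 2) ≤ (2 ^ r * (∣ N ∣ C 2)) ^ 3 * 3 ^ (m ∸ 2)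
lemma2p3 r G N N-normal _ _ m m*|N|≡r c c∉N L unique bads =
  cube-bound (length L) (2 ^ r * (∣ N ∣ C 2)) k (m ∸ 2)
    (bad-count L unique bads)
    (≤-trans (m∸n≤m m 2) (index≤3k m m*|N|≡r))
  where open CommonNeighbours G N N-normal c c∉N
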